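{- (i) For every $n\ge 2$, $\frac1n\le p_0(n)\le\frac4n$. (ii) As $n\to\infty$, $p_0(n)=\frac{2+o(1)}{n}$.
   Context: Let $\mathbb{S}_n$ be the symmetric group on $[n]=\{1,\ldots,n\}$ with the uniform probability measure. For $\pi\in\mathbb{S}_n$, $X_\pi$ is the simplicial complex on vertex set $[n]$ whose simplices are all $\{i_0,\ldots,i_m\}\subset[n]$ with $i_0<\cdots<i_m$ and $\pi(i_0)<\cdots<\pi(i_m)$. $p_0(n)=\Pr[\pi\in\mathbb{S}_n: X_\pi \text{ is not } 0\text{ -connected}]$, i.e. the probability that $X_\pi$ is disconnected. -}

module Defs where

open import Data.Nat using (ℕ; zero; suc; _!)
open import Data.Nat.Properties using (_!≢0)
open import Data.Fin using (Fin; _<_)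
open import Data.Fin.Properties using (_≟_; _<?_; all?; any?)
open import Data.Fin.Subset using (Subset; _∈_; _∉_)
open import Data.Fin.Subset.Properties using (_∈?_; anySubset?)
open import Data.Vec using (Vec; []; _∷_; lookup)
open import Data.List using (List; []; _∷_; concatMap; map; filter; length)
open import Data.Product using (_×_; ∃)
open import Data.Integer using (+_)
open import Data.Rational using (ℚ; _/_)
open import Relation.Binary.PropositionalEquality using (_≡_)
open import Relation.Nullary using (Dec; ¬_)
open import Relation.Nullary.Decidable using (_×-dec_; _→-dec_; ¬?)

allVecs : (n k : ℕ) → List (Vec (Fin n) k)
allVecs n zero    = [] ∷ []
allVecs n (suc k) = concatMap (λ v → map (_∷ v) (allFins n)) (allVecs n k)
  where
  allFins : (m : ℕ) → List (Fin m)
  allFins m = Data.List.allFin m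

IsPerm : {n : ℕ} → Vec (Fin n) n → Set
IsPerm {n} π = ∀ (i j : Fin n) → lookup π i ≡ lookup π j → i ≡ j

-- Vertices i, j span an edge (1-simplex) of X_π : i < j and π(i) < π(j).
Edge : {n : ℕ} → Vec (Fin n) n → Fin n → Fin n → Set
Edge π i j = (i < j) × (lookup π i < lookup π j)

-- X_π is disconnected (not 0-connected): the vertex set splits into two
-- nonempty parts S and its complement with no simplex meeting both.
-- (A simplex meets both parts iff it contains an edge with one endpoint in
-- each part, since every pair of vertices of a simplex is an edge.)
Separation : {n : ℕ} → Vec (Fin n) n → Subset n → Set
Separation {n} π S =
  ∃ (λ a → a ∈ S) × ∃ (λ b → b ∉ S) ×
  (∀ (i j : Fin n) → i ∈ S → j ∉ S → ¬ Edge π i j × ¬ Edge π j i)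

Disconnected : {n : ℕ} → Vec (Fin n) n → Set
Disconnected π = ∃ (λ S → Separation π S)

isPerm? : {n : ℕ} (π : Vec (Fin n) n) → Dec (IsPerm π)
isPerm? π = all? λ i → all? λ j → (lookup π i ≟ lookup π j) →-dec (i ≟ j)

edge? : {n : ℕ} (π : Vec (Fin n) n) (i j : Fin n) → Dec (Edge π i j)
edge? π i j = (i <? j) ×-dec (lookup π i <? lookup π j)

disconnected? : {n : ℕ} (π : Vec (Fin n) n) → Dec (Disconnected π)
disconnected? π = anySubset? λ S →
  any? (λ a → a ∈? S) ×-dec any? (λ b → ¬? (b ∈? S)) ×-dec
  all? (λ i → all? λ j → (i ∈? S) →-dec ((¬? (j ∈? S)) →-dec
        (¬? (edge? π i j) ×-dec ¬? (edge? π j i))))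

countDisconnected : ℕ → ℕ
countDisconnected n =
  length (filter (λ π → isPerm? π ×-dec disconnected? π) (allVecs n n))

p₀ : ℕ → ℚ
p₀ n = (+ countDisconnected n / n !) {{_!≢0 n}}

module Submission where

-- X_π is disconnected exactly when π is a skew sum σ ⊖ τ with σ of length k for some
-- 1 ≤ k < n, i.e. π maps the first k positions onto the k largest values: cut the side of a
-- separation containing vertex 0 at the first vertex it misses; since no edge crosses the
-- cut, every value before it exceeds every value after it. There are k! (n − k)! skew sums
-- at each k. The splits at 1 and at n − 1 give (n − 1)! permutations each and share
-- (n − 2)!, so 2 (n − 1)! − (n − 2)! ≤ #disconnected ≤ Σₖ k! (n − k)!, and the sum is at
-- most 4 (n − 1)!, and at most 2 (n − 1)! + 10 (n − 2)! once n ≥ 5. Dividing by n! gives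
-- 1/n ≤ p₀(n) ≤ 4/n and ∣ n p₀(n) − 2 ∣ ≤ 10/(n − 1).

open import Defs
open import Level using (0ℓ)
open import Function using (_∘_; id)
open import Data.Bool using (true)
open import Data.Empty using (⊥-elim)
open import Data.Product using (_×_; _,_; proj₁; proj₂; ∃; swap)
open import Data.Product.Properties using (≡-dec)
open import Data.Sum using (_⊎_; inj₁; inj₂; [_,_])
open import Relation.Nullary using (Dec; yes; no; ¬_; does; contradiction)
open import Relation.Nullary.Decidable using (_×-dec_; ¬?; dec-true; dec-false; decidable-stable)
open import Relation.Unary using (Pred; Decidable; Empty; _⊆_; _≐_; _∪_; _∩_)
open import Relation.Unary.Properties using (_∩?_; ∁?)
open import Relation.Binary.PropositionalEquality hiding ([_]; J)
open import Data.Nat as ℕ using (ℕ; zero; suc; _!; NonZero; pred; _≥_)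
open import Data.Nat.Properties as ℕ using (_!≢0)
open import Data.Fin using (Fin; zero; suc; toℕ; fromℕ<)
open import Data.Fin.Properties
  using (_≟_; suc-injective; toℕ<n; toℕ-fromℕ<; toℕ-injective; toℕ-inject; injective⇒≤; ¬∀⟶∃¬-smallest)
open import Data.Fin.Subset using (Subset) renaming (_∈_ to _∈ˢ_; _∉_ to _∉ˢ_)
open import Data.Fin.Subset.Properties using () renaming (_∈?_ to _∈ˢ?_)
open import Data.List using (List; []; _∷_; _++_; map; concatMap; filter; length; allFin)
open import Data.List.Properties using (map-++; map-∘; map-cong; map-tabulate)
open import Data.Vec using (Vec; []; _∷_; lookup; tabulate; toList)
open import Data.Vec.Properties using (tabulate∘lookup; lookup∘tabulate; []=⇒lookup; lookup⇒[]=)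
open import Data.Vec.Membership.Propositional using (_∈_; _∉_)
open import Data.Vec.Relation.Unary.All using (All; []; _∷_)
open import Data.Vec.Relation.Unary.Any using (here; there; any?)
open import Data.Vec.Relation.Unary.AllPairs using (AllPairs; []; _∷_; allPairs?)
open import Data.Vec.Relation.Unary.Unique.Propositional using (Unique)
open import Data.Vec.Relation.Unary.Unique.Propositional.Properties using (tabulate⁺; lookup-injective)
open import Data.Vec.Relation.Binary.Pointwise.Inductive as Pointwise using (Pointwise; []; _∷_)

module Combinatorics where

  open import Data.Nat using (_+_; _*_; _∸_; _≤_; _<_; _≤?_; _<?_; z≤n; s≤s; z<s; s≤s⁻¹)
  open import Data.Nat.Properties hiding (_≟_; suc-injective)
  open import Data.Nat.ListAction using (sum)
  open import Data.Nat.ListAction.Properties using (sum-++)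
  open import Data.Nat.Combinatorics.Base using (_P′_)
  open import Data.Nat.Tactic.RingSolver using (solve-∀)
  open import Algebra.Properties.CommutativeSemigroup +-commutativeSemigroup
    using () renaming (interchange to +-interchange)
  open import Algebra.Properties.CommutativeSemigroup *-commutativeSemigroup
    using () renaming (x∙yz≈y∙xz to x*[y*z]≡y*[x*z])

  private
    variable
      A B : Set
      n L : ℕ

  -- Counting with indicator sums

  indicator : {P : Set} → Dec P → ℕ
  indicator (yes _) = 1
  indicator (no _)  = 0

  indicator-mono : {P Q : Set} → (P → Q) → (p : Dec P) (q : Dec Q) → indicator p ≤ indicator q
  indicator-mono f (yes p) (yes q) = ≤-refl
  indicator-mono f (yes p) (no ¬q) = ⊥-elim (¬q (f p))
  indicator-mono f (no ¬p) q       = z≤n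

  indicator-cong : {P Q : Set} → (P → Q) → (Q → P) → (p : Dec P) (q : Dec Q) → indicator p ≡ indicator q
  indicator-cong f g p q = ≤-antisym (indicator-mono f p q) (indicator-mono g q p)

  indicator-yes : {P : Set} (p : Dec P) → P → indicator p ≡ 1
  indicator-yes (yes _) _  = refl
  indicator-yes (no ¬p) p  = ⊥-elim (¬p p)

  indicator-no : {P : Set} (p : Dec P) → ¬ P → indicator p ≡ 0
  indicator-no (yes p) ¬p = ⊥-elim (¬p p)
  indicator-no (no _)  _  = refl

  indicator-⊎ : {P Q R : Set} → (P → Q ⊎ R) → (p : Dec P) (q : Dec Q) (r : Dec R) →
                indicator p ≤ indicator q + indicator r
  indicator-⊎ f (no _)  q       r       = z≤n
  indicator-⊎ f (yes _) (yes _) r       = s≤s z≤n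
  indicator-⊎ f (yes _) (no _)  (yes _) = ≤-refl
  indicator-⊎ f (yes p) (no ¬q) (no ¬r) = ⊥-elim ([ ¬q , ¬r ] (f p))

  indicator-disjoint-⊎ : {P Q R : Set} → (P → Q ⊎ R) → (Q ⊎ R → P) → ¬ (Q × R) →
                         (p : Dec P) (q : Dec Q) (r : Dec R) → indicator p ≡ indicator q + indicator r
  indicator-disjoint-⊎ f g d p       (yes q) (yes r) = ⊥-elim (d (q , r))
  indicator-disjoint-⊎ f g d (yes _) (yes _) (no _)  = refl
  indicator-disjoint-⊎ f g d (yes _) (no _)  (yes _) = refl
  indicator-disjoint-⊎ f g d (no _)  (no _)  (no _)  = refl
  indicator-disjoint-⊎ f g d (no ¬p) (yes q) (no _)  = ⊥-elim (¬p (g (inj₁ q)))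
  indicator-disjoint-⊎ f g d (no ¬p) (no _)  (yes r) = ⊥-elim (¬p (g (inj₂ r)))
  indicator-disjoint-⊎ f g d (yes p) (no ¬q) (no ¬r) = ⊥-elim ([ ¬q , ¬r ] (f p))

  indicator-inclusion-exclusion : {P Q R S : Set} → (Q → P) → (R → P) → (Q × R → S) →
    (p : Dec P) (q : Dec Q) (r : Dec R) (s : Dec S) → indicator q + indicator r ≤ indicator p + indicator s
  indicator-inclusion-exclusion f g h p       (no _)  (no _)  s       = z≤n
  indicator-inclusion-exclusion f g h (no ¬p) (yes q) r       s       = ⊥-elim (¬p (f q))
  indicator-inclusion-exclusion f g h (no ¬p) (no _)  (yes r) s       = ⊥-elim (¬p (g r))
  indicator-inclusion-exclusion f g h (yes _) (yes q) (yes r) (no ¬s) = ⊥-elim (¬s (h (q , r)))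
  indicator-inclusion-exclusion f g h (yes _) (yes _) (yes _) (yes _) = ≤-refl
  indicator-inclusion-exclusion f g h (yes _) (yes _) (no _)  s       = s≤s z≤n
  indicator-inclusion-exclusion f g h (yes _) (no _)  (yes _) s       = s≤s z≤n

  -- A sum of indicators, so that counting (in)equalities reduce to pointwise ones.
  count : {P : Pred A 0ℓ} → Decidable P → List A → ℕ
  count P? xs = sum (map (λ x → indicator (P? x)) xs)

  length-filter≡count : {P : Pred A 0ℓ} (P? : Decidable P) (xs : List A) →
                        length (filter P? xs) ≡ count P? xs
  length-filter≡count P? []       = refl
  length-filter≡count P? (x ∷ xs) with P? x
  ... | yes _ = cong suc (length-filter≡count P? xs)
  ... | no _  = length-filter≡count P? xs

  sum-map-mono : {f g : A → ℕ} → (∀ x → f x ≤ g x) → ∀ xs → sum (map f xs) ≤ sum (map g xs)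
  sum-map-mono f≤g []       = z≤n
  sum-map-mono f≤g (x ∷ xs) = +-mono-≤ (f≤g x) (sum-map-mono f≤g xs)

  sum-map-cong : {f g : A → ℕ} → (∀ x → f x ≡ g x) → ∀ xs → sum (map f xs) ≡ sum (map g xs)
  sum-map-cong f≡g xs = cong sum (map-cong f≡g xs)

  sum-map-+ : (f g : A → ℕ) → ∀ xs → sum (map (λ x → f x + g x) xs) ≡ sum (map f xs) + sum (map g xs)
  sum-map-+ f g []       = refl
  sum-map-+ f g (x ∷ xs) =
    trans (cong (f x + g x +_) (sum-map-+ f g xs)) (+-interchange (f x) (g x) _ _)

  sum-map-*ʳ : (f : A → ℕ) (k : ℕ) → ∀ xs → sum (map (λ x → f x * k) xs) ≡ sum (map f xs) * k
  sum-map-*ʳ f k []       = refl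
  sum-map-*ʳ f k (x ∷ xs) = trans (cong (f x * k +_) (sum-map-*ʳ f k xs)) (sym (*-distribʳ-+ k (f x) _))

  module _ {P Q : Pred A 0ℓ} (P? : Decidable P) (Q? : Decidable Q) where

    count-mono : P ⊆ Q → ∀ xs → count P? xs ≤ count Q? xs
    count-mono P⊆Q = sum-map-mono λ x → indicator-mono P⊆Q (P? x) (Q? x)

    count-≐ : P ≐ Q → ∀ xs → count P? xs ≡ count Q? xs
    count-≐ (P⊆Q , Q⊆P) = sum-map-cong λ x → indicator-cong P⊆Q Q⊆P (P? x) (Q? x)

  module _ {P Q R : Pred A 0ℓ} (P? : Decidable P) (Q? : Decidable Q) (R? : Decidable R) where

    count-union : P ⊆ Q ∪ R → ∀ xs → count P? xs ≤ count Q? xs + count R? xs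
    count-union P⊆Q∪R xs = ≤-trans
      (sum-map-mono (λ x → indicator-⊎ P⊆Q∪R (P? x) (Q? x) (R? x)) xs)
      (≤-reflexive (sum-map-+ (λ x → indicator (Q? x)) (λ x → indicator (R? x)) xs))

    count-disjoint-union : P ≐ Q ∪ R → Empty (Q ∩ R) → ∀ xs → count P? xs ≡ count Q? xs + count R? xs
    count-disjoint-union (P⊆Q∪R , Q∪R⊆P) Q∩R=∅ xs = trans
      (sum-map-cong (λ x → indicator-disjoint-⊎ P⊆Q∪R Q∪R⊆P (Q∩R=∅ x) (P? x) (Q? x) (R? x)) xs)
      (sum-map-+ (λ x → indicator (Q? x)) (λ x → indicator (R? x)) xs)

  count-inclusion-exclusion : {P Q R S : Pred A 0ℓ}
    (P? : Decidable P) (Q? : Decidable Q) (R? : Decidable R) (S? : Decidable S) →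
    Q ⊆ P → R ⊆ P → Q ∩ R ⊆ S → ∀ xs → count Q? xs + count R? xs ≤ count P? xs + count S? xs
  count-inclusion-exclusion P? Q? R? S? Q⊆P R⊆P Q∩R⊆S xs = begin
    count Q? xs + count R? xs
      ≡⟨ sum-map-+ (λ x → indicator (Q? x)) (λ x → indicator (R? x)) xs ⟨
    sum (map (λ x → indicator (Q? x) + indicator (R? x)) xs)
      ≤⟨ sum-map-mono (λ x → indicator-inclusion-exclusion Q⊆P R⊆P Q∩R⊆S (P? x) (Q? x) (R? x) (S? x)) xs ⟩
    sum (map (λ x → indicator (P? x) + indicator (S? x)) xs)
      ≡⟨ sum-map-+ (λ x → indicator (P? x)) (λ x → indicator (S? x)) xs ⟩
    count P? xs + count S? xs ∎
    where open ≤-Reasoning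

  count-empty : {P : Pred A 0ℓ} (P? : Decidable P) → Empty P → ∀ xs → count P? xs ≡ 0
  count-empty P? P=∅ []       = refl
  count-empty P? P=∅ (x ∷ xs) with P? x
  ... | yes p = ⊥-elim (P=∅ x p)
  ... | no _  = count-empty P? P=∅ xs

  count-concatMap : {P : Pred B 0ℓ} (P? : Decidable P) (f : A → List B) → ∀ xs →
                    count P? (concatMap f xs) ≡ sum (map (count P? ∘ f) xs)
  count-concatMap P? f []       = refl
  count-concatMap {B = B} P? f (x ∷ xs) = begin
    sum (map ind (f x ++ concatMap f xs))               ≡⟨ cong sum (map-++ ind (f x) _) ⟩
    sum (map ind (f x) ++ map ind (concatMap f xs))     ≡⟨ sum-++ (map ind (f x)) _ ⟩
    count P? (f x) + count P? (concatMap f xs)          ≡⟨ cong (count P? (f x) +_) (count-concatMap P? f xs) ⟩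
    count P? (f x) + sum (map (count P? ∘ f) xs)        ∎
    where
    open ≡-Reasoning
    ind : B → ℕ
    ind y = indicator (P? y)

  count-map : {P : Pred B 0ℓ} (P? : Decidable P) (f : A → B) → ∀ xs →
              count P? (map f xs) ≡ count (P? ∘ f) xs
  count-map P? f xs = cong sum (sym (map-∘ xs))

  count-allFin-suc : ∀ n {P : Pred (Fin (suc n)) 0ℓ} (P? : Decidable P) →
    count P? (allFin (suc n)) ≡ indicator (P? zero) + count (P? ∘ suc) (allFin n)
  count-allFin-suc n P? = cong (indicator (P? zero) +_) (trans
    (cong sum (map-tabulate suc (λ x → indicator (P? x))))
    (sym (cong sum (map-tabulate id (λ x → indicator (P? (suc x)))))))

  count-≡ : (y : Fin n) → count (_≟ y) (allFin n) ≡ 1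
  count-≡ {suc n} zero    = trans (count-allFin-suc n (_≟ zero))
                                  (cong suc (count-empty (λ x → suc x ≟ zero) (λ _ ()) (allFin n)))
  count-≡ {suc n} (suc y) = begin
    count (_≟ suc y) (allFin (suc n))
      ≡⟨ count-allFin-suc n (_≟ suc y) ⟩
    count (λ x → suc x ≟ suc y) (allFin n)
      ≡⟨ count-≐ (λ x → suc x ≟ suc y) (_≟ y) (suc-injective , cong suc) (allFin n) ⟩
    count (_≟ y) (allFin n)
      ≡⟨ count-≡ y ⟩
    1 ∎
    where open ≡-Reasoning

  count-< : ∀ {b} → b ≤ n → count (λ (x : Fin n) → toℕ x <? b) (allFin n) ≡ b
  count-< {n}     {zero}  _         = count-empty (λ (x : Fin n) → toℕ x <? 0) (λ _ ()) (allFin n)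
  count-< {suc n} {suc b} (s≤s b≤n) = begin
    count (λ x → toℕ x <? suc b) (allFin (suc n))
      ≡⟨ count-allFin-suc n (λ x → toℕ x <? suc b) ⟩
    suc (count (λ x → suc (toℕ x) <? suc b) (allFin n))
      ≡⟨ cong suc (count-≐ (λ x → suc (toℕ x) <? suc b) (λ x → toℕ x <? b) (s≤s⁻¹ , s≤s) (allFin n)) ⟩
    suc (count (λ x → toℕ x <? b) (allFin n))
      ≡⟨ cong suc (count-< b≤n) ⟩
    suc b ∎
    where open ≡-Reasoning

  -- Injective vectors with values in prescribed intervals

  Interval : Set
  Interval = ℕ × ℕ

  infix 4 _∈ᵢ_ _∈ᵢ?_

  _∈ᵢ_ : ℕ → Interval → Set
  x ∈ᵢ (lo , hi) = lo ≤ x × x < hi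

  _∈ᵢ?_ : (x : ℕ) (I : Interval) → Dec (x ∈ᵢ I)
  x ∈ᵢ? (lo , hi) = (lo ≤? x) ×-dec (x <? hi)

  size : Interval → ℕ
  size (lo , hi) = hi ∸ lo

  _≟ᵢ_ : (I J : Interval) → Dec (I ≡ J)
  _≟ᵢ_ = ≡-dec ℕ._≟_ ℕ._≟_

  Disjoint : Interval → Interval → Set
  Disjoint I J = ∀ {x} → x ∈ᵢ I → ¬ x ∈ᵢ J

  EqualOrDisjoint : Interval → Interval → Set
  EqualOrDisjoint I J = I ≡ J ⊎ Disjoint I J

  count-∈ᵢ : ∀ {lo hi} → hi ≤ n → count (λ (x : Fin n) → toℕ x ∈ᵢ? (lo , hi)) (allFin n) ≡ hi ∸ lo
  count-∈ᵢ {n} {lo} {hi} hi≤n with lo ≤? hi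
  ... | yes lo≤hi = begin
    count ∈I? xs                       ≡⟨ m+n∸n≡m (count ∈I? xs) lo ⟨
    count ∈I? xs + lo ∸ lo             ≡⟨ cong (λ c → count ∈I? xs + c ∸ lo) (count-< (≤-trans lo≤hi hi≤n)) ⟨
    count ∈I? xs + count <lo? xs ∸ lo  ≡⟨ cong (_∸ lo) (count-disjoint-union <hi? ∈I? <lo? (split , merge) disjoint xs) ⟨
    count <hi? xs ∸ lo                 ≡⟨ cong (_∸ lo) (count-< hi≤n) ⟩
    hi ∸ lo                            ∎
    where
    open ≡-Reasoning
    xs : List (Fin n)
    xs = allFin n
    ∈I? : Decidable (λ (x : Fin n) → toℕ x ∈ᵢ (lo , hi))
    ∈I? x = toℕ x ∈ᵢ? (lo , hi)
    <lo? : Decidable (λ (x : Fin n) → toℕ x < lo)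
    <lo? x = toℕ x <? lo
    <hi? : Decidable (λ (x : Fin n) → toℕ x < hi)
    <hi? x = toℕ x <? hi
    split : ∀ {x} → toℕ x < hi → toℕ x ∈ᵢ (lo , hi) ⊎ toℕ x < lo
    split {x} x<hi with lo ≤? toℕ x
    ... | yes lo≤x = inj₁ (lo≤x , x<hi)
    ... | no lo≰x  = inj₂ (≰⇒> lo≰x)
    merge : ∀ {x} → toℕ x ∈ᵢ (lo , hi) ⊎ toℕ x < lo → toℕ x < hi
    merge (inj₁ (_ , x<hi)) = x<hi
    merge (inj₂ x<lo)       = <-≤-trans x<lo lo≤hi
    disjoint : ∀ x → ¬ (toℕ x ∈ᵢ (lo , hi) × toℕ x < lo)
    disjoint x ((lo≤x , _) , x<lo) = <⇒≱ x<lo lo≤x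
  ... | no lo≰hi = trans
    (count-empty (λ (x : Fin n) → toℕ x ∈ᵢ? (lo , hi)) (λ _ (lo≤x , x<hi) → lo≰hi (≤-trans lo≤x (<⇒≤ x<hi))) (allFin n))
    (sym (m≤n⇒m∸n≡0 (<⇒≤ (≰⇒> lo≰hi))))

  _∈?_ : (x : Fin n) (v : Vec (Fin n) L) → Dec (x ∈ v)
  x ∈? v = any? (x ≟_) v

  all≢⇒∉ : ∀ {x : Fin n} {v : Vec (Fin n) L} → All (x ≢_) v → x ∉ v
  all≢⇒∉ (x≢y ∷ _)  (here x≡y)  = x≢y x≡y
  all≢⇒∉ (_ ∷ x≢ys) (there x∈v) = all≢⇒∉ x≢ys x∈v

  ∉⇒all≢ : ∀ {x : Fin n} {v : Vec (Fin n) L} → x ∉ v → All (x ≢_) v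
  ∉⇒all≢ {v = []}    _   = []
  ∉⇒all≢ {v = y ∷ v} x∉v = (x∉v ∘ here) ∷ ∉⇒all≢ (x∉v ∘ there)

  Fits : Vec Interval L → Vec (Fin n) L → Set
  Fits = Pointwise (λ I x → toℕ x ∈ᵢ I)

  Admissible : Vec Interval L → Vec (Fin n) L → Set
  Admissible is v = Unique v × Fits is v

  admissible? : (is : Vec Interval L) (v : Vec (Fin n) L) → Dec (Admissible is v)
  admissible? is v = allPairs? (λ x y → ¬? (x ≟ y)) v ×-dec Pointwise.decidable (λ I x → toℕ x ∈ᵢ? I) is v

  multiplicity : Interval → Vec Interval L → ℕ
  multiplicity I is = count (_≟ᵢ I) (toList is)

  -- Filling a vector from its last entry to its first, the entry with interval I may take any
  -- value of I except the multiplicity I is values taken by later entries with the same interval;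
  -- later entries with a disjoint interval take none of them.
  arrangements : Vec Interval L → ℕ
  arrangements []       = 1
  arrangements (I ∷ is) = (size I ∸ multiplicity I is) * arrangements is

  count-∈ : {P : Pred (Fin n) 0ℓ} (P? : Decidable P) {v : Vec (Fin n) L} → Unique v →
            count (P? ∩? (_∈? v)) (allFin n) ≡ count P? (toList v)
  count-∈ {n} P? {[]} [] = count-empty (P? ∩? (_∈? [])) (λ _ ()) (allFin n)
  count-∈ {n} {P = P} P? {y ∷ v} (y∉v ∷ unique) = begin
    count (P? ∩? (_∈? (y ∷ v))) xs
      ≡⟨ count-disjoint-union (P? ∩? (_∈? (y ∷ v))) (P? ∩? (_≟ y)) (P? ∩? (_∈? v)) (split , merge) disjoint xs ⟩
    count (P? ∩? (_≟ y)) xs + count (P? ∩? (_∈? v)) xs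
      ≡⟨ cong₂ _+_ count-at-y (count-∈ P? unique) ⟩
    indicator (P? y) + count P? (toList v) ∎
    where
    open ≡-Reasoning
    xs : List (Fin n)
    xs = allFin n
    split : ∀ {x} → P x × x ∈ y ∷ v → P x × x ≡ y ⊎ P x × x ∈ v
    split (px , here x≡y)  = inj₁ (px , x≡y)
    split (px , there x∈v) = inj₂ (px , x∈v)
    merge : ∀ {x} → P x × x ≡ y ⊎ P x × x ∈ v → P x × x ∈ y ∷ v
    merge (inj₁ (px , x≡y)) = px , here x≡y
    merge (inj₂ (px , x∈v)) = px , there x∈v
    disjoint : ∀ x → ¬ ((P x × x ≡ y) × (P x × x ∈ v))
    disjoint x ((_ , refl) , (_ , x∈v)) = all≢⇒∉ y∉v x∈v
    count-at-y : count (P? ∩? (_≟ y)) xs ≡ indicator (P? y)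
    count-at-y with P? y
    ... | yes py = trans (count-≐ (P? ∩? (_≟ y)) (_≟ y) (proj₂ , λ { refl → py , refl }) xs) (count-≡ y)
    ... | no ¬py = count-empty (P? ∩? (_≟ y)) (λ { x (px , refl) → ¬py px }) xs

  count-values-∈ᵢ : ∀ {I} {is : Vec Interval L} {v : Vec (Fin n) L} → All (EqualOrDisjoint I) is → Fits is v →
                    count (λ x → toℕ x ∈ᵢ? I) (toList v) ≡ multiplicity I is
  count-values-∈ᵢ []               []           = refl
  count-values-∈ᵢ {I = I} {J ∷ is} {y ∷ v} (I≈J ∷ I≈is) (y∈J ∷ fits) =
    cong₂ _+_ (indicator-cong J≡I (λ { refl → y∈J }) (toℕ y ∈ᵢ? I) (J ≟ᵢ I)) (count-values-∈ᵢ I≈is fits)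
    where
    J≡I : toℕ y ∈ᵢ I → J ≡ I
    J≡I y∈I = [ sym , (λ I∩J=∅ → ⊥-elim (I∩J=∅ y∈I y∈J)) ] I≈J

  count-extensions : ∀ {I} {is : Vec Interval L} {v : Vec (Fin n) L} →
    All (EqualOrDisjoint I) is → proj₂ I ≤ n → Admissible is v →
    count (λ x → admissible? (I ∷ is) (x ∷ v)) (allFin n) ≡ size I ∸ multiplicity I is
  count-extensions {L} {n} {I} {is} {v} I≈is hi≤n (unique , fits) = begin
    count (λ x → admissible? (I ∷ is) (x ∷ v)) xs
      ≡⟨ count-≐ (λ x → admissible? (I ∷ is) (x ∷ v)) (∈I? ∩? ∁? (_∈? v)) (restrict , extend) xs ⟩
    count (∈I? ∩? ∁? (_∈? v)) xs
      ≡⟨ m+n∸n≡m _ (count (∈I? ∩? (_∈? v)) xs) ⟨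
    count (∈I? ∩? ∁? (_∈? v)) xs + count (∈I? ∩? (_∈? v)) xs ∸ count (∈I? ∩? (_∈? v)) xs
      ≡⟨ cong₂ _∸_ (count-disjoint-union ∈I? (∈I? ∩? ∁? (_∈? v)) (∈I? ∩? (_∈? v)) (split , merge) disjoint xs)
                   (sym (count-∈ ∈I? unique)) ⟨
    count ∈I? xs ∸ count ∈I? (toList v)
      ≡⟨ cong₂ _∸_ (count-∈ᵢ hi≤n) (count-values-∈ᵢ I≈is fits) ⟩
    size I ∸ multiplicity I is ∎
    where
    open ≡-Reasoning
    xs : List (Fin n)
    xs = allFin n
    ∈I? : Decidable (λ (x : Fin n) → toℕ x ∈ᵢ I)
    ∈I? x = toℕ x ∈ᵢ? I
    restrict : ∀ {x} → Admissible (I ∷ is) (x ∷ v) → toℕ x ∈ᵢ I × x ∉ v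
    restrict (x≢v ∷ _ , x∈I ∷ _) = x∈I , all≢⇒∉ x≢v
    extend : ∀ {x} → toℕ x ∈ᵢ I × x ∉ v → Admissible (I ∷ is) (x ∷ v)
    extend (x∈I , x∉v) = ∉⇒all≢ x∉v ∷ unique , x∈I ∷ fits
    split : ∀ {x} → toℕ x ∈ᵢ I → toℕ x ∈ᵢ I × x ∉ v ⊎ toℕ x ∈ᵢ I × x ∈ v
    split {x} x∈I with x ∈? v
    ... | yes x∈v = inj₂ (x∈I , x∈v)
    ... | no x∉v  = inj₁ (x∈I , x∉v)
    merge : ∀ {x} → toℕ x ∈ᵢ I × x ∉ v ⊎ toℕ x ∈ᵢ I × x ∈ v → toℕ x ∈ᵢ I
    merge (inj₁ (x∈I , _)) = x∈I
    merge (inj₂ (x∈I , _)) = x∈I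
    disjoint : ∀ x → ¬ ((toℕ x ∈ᵢ I × x ∉ v) × (toℕ x ∈ᵢ I × x ∈ v))
    disjoint x ((_ , x∉v) , (_ , x∈v)) = x∉v x∈v

  count-admissible : (is : Vec Interval L) → AllPairs EqualOrDisjoint is → All (λ I → proj₂ I ≤ n) is →
                     count (admissible? is) (allVecs n L) ≡ arrangements is
  count-admissible []       []               []             = refl
  count-admissible {suc L} {n} (I ∷ is) (I≈is ∷ pairwise) (hi≤n ∷ his≤n) = begin
    count (admissible? (I ∷ is)) (concatMap extensions (allVecs n L))
      ≡⟨ count-concatMap (admissible? (I ∷ is)) extensions (allVecs n L) ⟩
    sum (map (count (admissible? (I ∷ is)) ∘ extensions) (allVecs n L))
      ≡⟨ sum-map-cong count-extensions-of (allVecs n L) ⟩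
    sum (map (λ v → indicator (admissible? is v) * m) (allVecs n L))
      ≡⟨ sum-map-*ʳ (λ v → indicator (admissible? is v)) m (allVecs n L) ⟩
    count (admissible? is) (allVecs n L) * m
      ≡⟨ cong (_* m) (count-admissible is pairwise his≤n) ⟩
    arrangements is * m
      ≡⟨ *-comm (arrangements is) m ⟩
    arrangements (I ∷ is) ∎
    where
    open ≡-Reasoning
    m : ℕ
    m = size I ∸ multiplicity I is
    extensions : Vec (Fin n) L → List (Vec (Fin n) (suc L))
    extensions v = map (_∷ v) (allFin n)
    count-extensions-of : ∀ v → count (admissible? (I ∷ is)) (extensions v) ≡ indicator (admissible? is v) * m
    count-extensions-of v with admissible? is v
    ... | yes adm = trans (count-map (admissible? (I ∷ is)) (_∷ v) (allFin n))
                          (trans (count-extensions I≈is hi≤n adm) (sym (+-identityʳ m)))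
    ... | no ¬adm = trans (count-map (admissible? (I ∷ is)) (_∷ v) (allFin n))
                          (count-empty _ (λ { x (_ ∷ unique , _ ∷ fits) → ¬adm (unique , fits) }) (allFin n))

  P′-suc : ∀ n k → suc n P′ suc k ≡ suc n * (n P′ k)
  P′-suc n zero    = refl
  P′-suc n (suc k) = begin
    (n ∸ k) * (suc n P′ suc k)     ≡⟨ cong ((n ∸ k) *_) (P′-suc n k) ⟩
    (n ∸ k) * (suc n * (n P′ k))   ≡⟨ x*[y*z]≡y*[x*z] (n ∸ k) (suc n) (n P′ k) ⟩
    suc n * ((n ∸ k) * (n P′ k))   ∎
    where open ≡-Reasoning

  nP′n≡n! : ∀ n → n P′ n ≡ n !
  nP′n≡n! zero    = refl
  nP′n≡n! (suc n) = trans (P′-suc n n) (cong (suc n *_) (nP′n≡n! n))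

  blocks : (L k : ℕ) → Interval → Interval → Vec Interval L
  blocks zero    k       I J = []
  blocks (suc L) zero    I J = J ∷ blocks L zero I J
  blocks (suc L) (suc k) I J = I ∷ blocks L k I J

  all-blocks : ∀ {L k I J} {P : Interval → Set} → P I → P J → All P (blocks L k I J)
  all-blocks {zero}          pI pJ = []
  all-blocks {suc L} {zero}  pI pJ = pJ ∷ all-blocks pI pJ
  all-blocks {suc L} {suc k} pI pJ = pI ∷ all-blocks pI pJ

  blocks-pairwise : ∀ {L k I J} → Disjoint I J → AllPairs EqualOrDisjoint (blocks L k I J)
  blocks-pairwise {zero}          I∩J=∅ = []
  blocks-pairwise {suc L} {zero}  I∩J=∅ =
    all-blocks (inj₂ (λ x∈J x∈I → I∩J=∅ x∈I x∈J)) (inj₁ refl) ∷ blocks-pairwise I∩J=∅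
  blocks-pairwise {suc L} {suc k} I∩J=∅ = all-blocks (inj₁ refl) (inj₂ I∩J=∅) ∷ blocks-pairwise I∩J=∅

  multiplicity-blocks-first : ∀ {L k I J} → J ≢ I → k ≤ L → multiplicity I (blocks L k I J) ≡ k
  multiplicity-blocks-first {zero}                J≢I z≤n       = refl
  multiplicity-blocks-first {suc L} {zero}  {I} {J} J≢I z≤n       =
    cong₂ _+_ (indicator-no (J ≟ᵢ I) J≢I) (multiplicity-blocks-first {L} {zero} {I} {J} J≢I z≤n)
  multiplicity-blocks-first {suc L} {suc k} {I} {J} J≢I (s≤s k≤L) =
    cong₂ _+_ (indicator-yes (I ≟ᵢ I) refl) (multiplicity-blocks-first {L} {k} {I} {J} J≢I k≤L)

  multiplicity-blocks-second : ∀ {L I J} → multiplicity J (blocks L 0 I J) ≡ L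
  multiplicity-blocks-second {zero}          = refl
  multiplicity-blocks-second {suc L} {I} {J} =
    cong₂ _+_ (indicator-yes (J ≟ᵢ J) refl) (multiplicity-blocks-second {L} {I} {J})

  multiplicity-blocks-other : ∀ {L k I J K} → I ≢ K → J ≢ K → multiplicity K (blocks L k I J) ≡ 0
  multiplicity-blocks-other {zero}                      I≢K J≢K = refl
  multiplicity-blocks-other {suc L} {zero}  {I} {J} {K} I≢K J≢K =
    cong₂ _+_ (indicator-no (J ≟ᵢ K) J≢K) (multiplicity-blocks-other {L} {zero} {I} {J} {K} I≢K J≢K)
  multiplicity-blocks-other {suc L} {suc k} {I} {J} {K} I≢K J≢K =
    cong₂ _+_ (indicator-no (I ≟ᵢ K) I≢K) (multiplicity-blocks-other {L} {k} {I} {J} {K} I≢K J≢K)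

  arrangements-blocks-second : ∀ {L I J} → arrangements (blocks L 0 I J) ≡ size J P′ L
  arrangements-blocks-second {zero}          = refl
  arrangements-blocks-second {suc L} {I} {J} =
    cong₂ (λ m a → (size J ∸ m) * a) (multiplicity-blocks-second {L} {I} {J}) (arrangements-blocks-second {L} {I} {J})

  arrangements-blocks : ∀ {L k I J} → J ≢ I → k ≤ L →
                        arrangements (blocks L k I J) ≡ (size I P′ k) * (size J P′ (L ∸ k))
  arrangements-blocks {L} {zero} {I} {J} J≢I z≤n =
    trans (arrangements-blocks-second {L} {I} {J}) (sym (*-identityˡ _))
  arrangements-blocks {suc L} {suc k} {I} {J} J≢I (s≤s k≤L) = begin
    (size I ∸ multiplicity I (blocks L k I J)) * arrangements (blocks L k I J)
      ≡⟨ cong₂ (λ m a → (size I ∸ m) * a) (multiplicity-blocks-first {L} {k} {I} {J} J≢I k≤L)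
                                          (arrangements-blocks {L} {k} {I} {J} J≢I k≤L) ⟩
    (size I ∸ k) * ((size I P′ k) * (size J P′ (L ∸ k)))
      ≡⟨ *-assoc (size I ∸ k) _ _ ⟨
    (size I P′ suc k) * (size J P′ (L ∸ k)) ∎
    where open ≡-Reasoning

  fits-blocks : ∀ {L k I J} {v : Vec (Fin n) L} →
    (∀ i → toℕ i < k → toℕ (lookup v i) ∈ᵢ I) → (∀ i → k ≤ toℕ i → toℕ (lookup v i) ∈ᵢ J) →
    Fits (blocks L k I J) v
  fits-blocks {k = k}     {v = []}    below above = []
  fits-blocks {k = zero}  {v = x ∷ v} below above =
    above zero z≤n ∷ fits-blocks (λ i ()) (λ i _ → above (suc i) z≤n)
  fits-blocks {k = suc k} {v = x ∷ v} below above =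
    below zero (s≤s z≤n) ∷ fits-blocks (λ i i<k → below (suc i) (s≤s i<k)) (λ i k≤i → above (suc i) (s≤s k≤i))

  fits-blocks-< : ∀ {L k I J} {v : Vec (Fin n) L} → Fits (blocks L k I J) v →
                  ∀ i → toℕ i < k → toℕ (lookup v i) ∈ᵢ I
  fits-blocks-< {k = suc k} (x∈I ∷ _)    zero    _         = x∈I
  fits-blocks-< {k = suc k} (_   ∷ fits) (suc i) (s≤s i<k) = fits-blocks-< fits i i<k

  fits-blocks-≥ : ∀ {L k I J} {v : Vec (Fin n) L} → Fits (blocks L k I J) v →
                  ∀ i → k ≤ toℕ i → toℕ (lookup v i) ∈ᵢ J
  fits-blocks-≥ {k = zero}  (x∈J ∷ _)    zero    _         = x∈J
  fits-blocks-≥ {k = zero}  (_   ∷ fits) (suc i) _         = fits-blocks-≥ fits i z≤n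
  fits-blocks-≥ {k = suc k} (_   ∷ fits) (suc i) (s≤s k≤i) = fits-blocks-≥ fits i k≤i

  -- Skew sums

  -- SkewSplit k π: π = σ ⊖ τ with σ of length k, i.e. π maps the first k positions onto the
  -- k largest values.
  skewIntervals : (n k : ℕ) → Vec Interval n
  skewIntervals n k = blocks n k (n ∸ k , n) (0 , n ∸ k)

  SkewSplit : (k : ℕ) → Vec (Fin n) n → Set
  SkewSplit {n} k = Admissible (skewIntervals n k)

  count-skewSplit : ∀ {k} → 1 ≤ k → k ≤ n → count (admissible? (skewIntervals n k)) (allVecs n n) ≡ k ! * (n ∸ k) !
  count-skewSplit {n} {k} 1≤k k≤n = begin
    count (admissible? (skewIntervals n k)) (allVecs n n)
      ≡⟨ count-admissible (skewIntervals n k) (blocks-pairwise disjoint) (all-blocks ≤-refl (m∸n≤m n k)) ⟩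
    arrangements (skewIntervals n k)
      ≡⟨ arrangements-blocks {n} {k} bottom≢top k≤n ⟩
    ((n ∸ (n ∸ k)) P′ k) * ((n ∸ k) P′ (n ∸ k))
      ≡⟨ cong₂ _*_ (trans (cong (_P′ k) (m∸[m∸n]≡n k≤n)) (nP′n≡n! k)) (nP′n≡n! (n ∸ k)) ⟩
    k ! * (n ∸ k) ! ∎
    where
    open ≡-Reasoning
    disjoint : Disjoint (n ∸ k , n) (0 , n ∸ k)
    disjoint (n∸k≤x , _) (_ , x<n∸k) = <⇒≱ x<n∸k n∸k≤x
    bottom≢top : (0 , n ∸ k) ≢ (n ∸ k , n)
    bottom≢top eq = <⇒≱ 1≤k (≤-reflexive (trans (sym (m∸[m∸n]≡n k≤n)) (trans (cong (n ∸_) n∸k≡n) (n∸n≡0 n))))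
      where
      n∸k≡n : n ∸ k ≡ n
      n∸k≡n = cong proj₂ eq

  -- π(0) = n − 1 and π(n − 1) = 0 for n = m + 2: the permutations splitting both at 1 and at n − 1.
  bothEndsIntervals : (m : ℕ) → Vec Interval (suc (suc m))
  bothEndsIntervals m = (suc m , suc (suc m)) ∷ blocks (suc m) m (1 , suc m) (0 , 1)

  count-bothEnds : ∀ m → count (admissible? (bothEndsIntervals m)) (allVecs (suc (suc m)) (suc (suc m))) ≡ m !
  count-bothEnds m = begin
    count (admissible? (bothEndsIntervals m)) (allVecs (suc (suc m)) (suc (suc m)))
      ≡⟨ count-admissible (bothEndsIntervals m) (all-blocks (inj₂ top∩middle=∅) (inj₂ top∩bottom=∅) ∷ blocks-pairwise middle∩bottom=∅)
                          (≤-refl ∷ all-blocks (n≤1+n (suc m)) (s≤s z≤n)) ⟩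
    arrangements (bothEndsIntervals m)
      ≡⟨ cong₂ (λ μ a → (size top ∸ μ) * a) (multiplicity-blocks-other {suc m} {m} (λ ()) (λ ()))
                                            (arrangements-blocks {suc m} {m} (λ ()) (n≤1+n m)) ⟩
    (suc m ∸ m) * ((m P′ m) * (1 P′ (suc m ∸ m)))
      ≡⟨ cong (λ t → t * ((m P′ m) * (1 P′ t))) (m+n∸n≡m 1 m) ⟩
    1 * ((m P′ m) * 1)
      ≡⟨ trans (*-identityˡ _) (trans (*-identityʳ _) (nP′n≡n! m)) ⟩
    m ! ∎
    where
    open ≡-Reasoning
    top : Interval
    top = (suc m , suc (suc m))
    top∩middle=∅ : Disjoint top (1 , suc m)
    top∩middle=∅ (m<x , _) (_ , x<m) = <⇒≱ x<m m<x
    top∩bottom=∅ : Disjoint top (0 , 1)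
    top∩bottom=∅ (m<x , _) (_ , x<1) = <⇒≱ x<1 (≤-trans (s≤s z≤n) m<x)
    middle∩bottom=∅ : Disjoint (1 , suc m) (0 , 1)
    middle∩bottom=∅ (1≤x , _) (_ , x<1) = <⇒≱ x<1 1≤x

  isPerm⇒unique : {π : Vec (Fin n) n} → IsPerm π → Unique π
  isPerm⇒unique {π = π} injective = subst Unique (tabulate∘lookup π) (tabulate⁺ (λ {i} {j} → injective i j))

  prefix : (k : ℕ) → Subset n
  prefix k = tabulate (λ i → does (toℕ i <? k))

  ∈-prefix : ∀ {k} {i : Fin n} → toℕ i < k → i ∈ˢ prefix k
  ∈-prefix {k = k} {i} i<k = lookup⇒[]= i (prefix k) (trans (lookup∘tabulate _ i) (dec-true (toℕ i <? k) i<k))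

  ∈-prefix⁻ : ∀ {k} {i : Fin n} → i ∈ˢ prefix k → toℕ i < k
  ∈-prefix⁻ {k = k} {i} i∈prefix =
    decidable-stable (toℕ i <? k) (λ i≮k → contradiction (trans (sym does≡true) (dec-false (toℕ i <? k) i≮k)) λ ())
    where
    does≡true : does (toℕ i <? k) ≡ true
    does≡true = trans (sym (lookup∘tabulate _ i)) ([]=⇒lookup i∈prefix)

  skewSplit⇒disconnected : ∀ {k} {π : Vec (Fin n) n} → 1 ≤ k → k < n → SkewSplit k π → Disconnected π
  skewSplit⇒disconnected {n} {k} {π} 1≤k k<n (_ , fits) =
    prefix k , (first , ∈-prefix first<k) , (fromℕ< k<n , k∉prefix) , separated
    where
    first : Fin n
    first = fromℕ< (<-trans 1≤k k<n)
    first<k : toℕ first < k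
    first<k = subst (_< k) (sym (toℕ-fromℕ< (<-trans 1≤k k<n))) 1≤k
    k∉prefix : fromℕ< k<n ∉ˢ prefix k
    k∉prefix k∈prefix = <-irrefl (toℕ-fromℕ< k<n) (∈-prefix⁻ k∈prefix)
    separated : ∀ i j → i ∈ˢ prefix k → j ∉ˢ prefix k → ¬ Edge π i j × ¬ Edge π j i
    separated i j i∈prefix j∉prefix = (λ (_ , πi<πj) → <-asym πi<πj πj<πi) , (λ (j<i , _) → <-asym j<i (<-≤-trans i<k k≤j))
      where
      i<k : toℕ i < k
      i<k = ∈-prefix⁻ i∈prefix
      k≤j : k ≤ toℕ j
      k≤j = ≮⇒≥ (j∉prefix ∘ ∈-prefix)
      πj<πi : toℕ (lookup π j) < toℕ (lookup π i)
      πj<πi = <-≤-trans (proj₂ (fits-blocks-≥ fits j k≤j)) (proj₁ (fits-blocks-< fits i i<k))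

  skewSplit-both-ends : ∀ m {π : Vec (Fin (suc (suc m))) (suc (suc m))} →
    SkewSplit 1 π → SkewSplit (suc m) π → Admissible (bothEndsIntervals m) π
  skewSplit-both-ends m {x ∷ v} (unique , x∈top ∷ fits₁) (_ , _ ∷ fits₂) =
    unique , x∈top ∷ fits-blocks (λ i i<m → middle (fits-blocks-≥ fits₁ i z≤n) (fits-blocks-< fits₂ i i<m))
                                 (λ i m≤i → bottom (fits-blocks-≥ fits₁ i z≤n) (fits-blocks-≥ fits₂ i m≤i))
    where
    1+m∸m≡1 : suc m ∸ m ≡ 1
    1+m∸m≡1 = m+n∸n≡m 1 m
    middle : ∀ {x} → x ∈ᵢ (0 , suc m) → x ∈ᵢ (suc m ∸ m , suc (suc m)) → x ∈ᵢ (1 , suc m)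
    middle {x} (_ , x<1+m) (1+m∸m≤x , _) = subst (_≤ x) 1+m∸m≡1 1+m∸m≤x , x<1+m
    bottom : ∀ {x} → x ∈ᵢ (0 , suc m) → x ∈ᵢ (0 , suc m ∸ m) → x ∈ᵢ (0 , 1)
    bottom {x} _ (_ , x<1+m∸m) = z≤n , subst (x <_) 1+m∸m≡1 x<1+m∸m

  injective-into-interval : ∀ {a lo hi} (f : Fin a → ℕ) → (∀ {x y} → f x ≡ f y → x ≡ y) →
                            (∀ x → f x ∈ᵢ (lo , hi)) → a ≤ hi ∸ lo
  injective-into-interval {a} {lo} {hi} f f-injective f∈I = injective⇒≤ {f = g} g-injective
    where
    bound : ∀ x → f x ∸ lo < hi ∸ lo
    bound x = ∸-monoˡ-< (proj₂ (f∈I x)) (proj₁ (f∈I x))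
    g : Fin a → Fin (hi ∸ lo)
    g x = fromℕ< (bound x)
    g-injective : ∀ {x y} → g x ≡ g y → x ≡ y
    g-injective {x} {y} gx≡gy = f-injective (∸-cancelʳ-≡ (proj₁ (f∈I x)) (proj₁ (f∈I y))
      (trans (sym (toℕ-fromℕ< (bound x))) (trans (cong toℕ gx≡gy) (toℕ-fromℕ< (bound y)))))

  shift : ∀ {a} o → o + a ≤ n → Fin a → Fin n
  shift o o+a≤n x = fromℕ< (<-≤-trans (+-monoʳ-< o (toℕ<n x)) o+a≤n)

  toℕ-shift : ∀ {a} o (o+a≤n : o + a ≤ n) (x : Fin a) → toℕ (shift o o+a≤n x) ≡ o + toℕ x
  toℕ-shift o o+a≤n x = toℕ-fromℕ< _

  smallest-failure : {A : Pred (Fin n) 0ℓ} → Decidable A → ∀ {b} → ¬ A b →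
                     ∃ λ k → ¬ A k × (∀ i → toℕ i < toℕ k → A i)
  smallest-failure {n} {A} A? ¬Ab with ¬∀⟶∃¬-smallest n A A? (λ ∀A → ¬Ab (∀A _))
  ... | k , ¬Ak , A-below-k = k , ¬Ak , λ i i<k →
    subst A (toℕ-injective (trans (toℕ-inject (fromℕ< i<k)) (toℕ-fromℕ< i<k))) (A-below-k (fromℕ< i<k))

  module _ {π : Vec (Fin n) n} (injective : IsPerm π) where

    private
      value : Fin n → ℕ
      value i = toℕ (lookup π i)

      NoCrossing : Pred (Fin n) 0ℓ → Set
      NoCrossing A = ∀ i j → A i → ¬ A j → ¬ Edge π i j × ¬ Edge π j i

    ¬edge⇒descent : ∀ {i j} → toℕ i < toℕ j → ¬ Edge π i j → value j < value i
    ¬edge⇒descent {i} {j} i<j ¬edge = ≤∧≢⇒< (≮⇒≥ (λ πi<πj → ¬edge (i<j , πi<πj)))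
      (λ πj≡πi → <-irrefl (cong toℕ (sym (injective j i (toℕ-injective πj≡πi)))) i<j)

    value-shift-injective : ∀ {a} o (o+a≤n : o + a ≤ n) {x y : Fin a} →
      value (shift o o+a≤n x) ≡ value (shift o o+a≤n y) → x ≡ y
    value-shift-injective o o+a≤n {x} {y} eq = toℕ-injective (+-cancelˡ-≡ o _ _
      (trans (sym (toℕ-shift o o+a≤n x))
      (trans (cong toℕ (injective _ _ (toℕ-injective eq))) (toℕ-shift o o+a≤n y))))

    -- No edge joins A to its complement and cut is the first vertex outside A, so every value
    -- before the cut exceeds every value after it; injectivity then makes them the top values.
    module _ {A : Pred (Fin n) 0ℓ} (A? : Decidable A) (no-crossing : NoCrossing A)
             {cut : Fin n} (¬A-cut : ¬ A cut) (A-below-cut : ∀ i → toℕ i < toℕ cut → A i) where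

      private
        k : ℕ
        k = toℕ cut
        k≤n : k ≤ n
        k≤n = <⇒≤ (toℕ<n cut)

      prefix-above-suffix : ∀ {i j} → toℕ i < k → k ≤ toℕ j → value j < value i
      prefix-above-suffix {i} {j} i<k k≤j with A? j
      ... | no ¬Aj = ¬edge⇒descent (<-≤-trans i<k k≤j) (proj₁ (no-crossing i j (A-below-cut i i<k) ¬Aj))
      ... | yes Aj = <-trans (¬edge⇒descent k<j (proj₂ (no-crossing j cut Aj ¬A-cut)))
                             (¬edge⇒descent i<k (proj₁ (no-crossing i cut (A-below-cut i i<k) ¬A-cut)))
        where
        k<j : k < toℕ j
        k<j = ≤∧≢⇒< k≤j (λ k≡j → ¬A-cut (subst A (toℕ-injective (sym k≡j)) Aj))

      suffix-below : ∀ {j} → k ≤ toℕ j → value j < n ∸ k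
      suffix-below {j} k≤j = m+n≤o⇒m≤o∸n (suc (value j)) (subst (_≤ n) (+-comm k _)
        (m≤o∸n⇒m+n≤o k (toℕ<n (lookup π j)) (injective-into-interval above (value-shift-injective 0 k≤n) above∈)))
        where
        above : Fin k → ℕ
        above x = value (shift 0 k≤n x)
        above∈ : ∀ x → above x ∈ᵢ (suc (value j) , n)
        above∈ x = prefix-above-suffix (subst (_< k) (sym (toℕ-shift 0 k≤n x)) (toℕ<n x)) k≤j , toℕ<n _

      prefix-above : ∀ {i} → toℕ i < k → n ∸ k ≤ value i
      prefix-above {i} i<k = injective-into-interval below (value-shift-injective k k+[n∸k]≤n) below∈
        where
        k+[n∸k]≤n : k + (n ∸ k) ≤ n
        k+[n∸k]≤n = ≤-reflexive (m+[n∸m]≡n k≤n)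
        below : Fin (n ∸ k) → ℕ
        below x = value (shift k k+[n∸k]≤n x)
        below∈ : ∀ x → below x ∈ᵢ (0 , value i)
        below∈ x = z≤n , prefix-above-suffix i<k (subst (k ≤_) (sym (toℕ-shift k k+[n∸k]≤n x)) (m≤m+n k (toℕ x)))

      cut⇒skewSplit : SkewSplit k π
      cut⇒skewSplit = isPerm⇒unique injective
                    , fits-blocks (λ i i<k → prefix-above i<k , toℕ<n _) (λ j k≤j → z≤n , suffix-below k≤j)

    cut-exists : {A : Pred (Fin n) 0ℓ} → Decidable A → NoCrossing A → ∀ {a b} → toℕ a ≡ 0 → A a → ¬ A b →
                 ∃ λ k → 1 ≤ k × k < n × SkewSplit k π
    cut-exists {A} A? no-crossing {a} a≡0 Aa ¬Ab with smallest-failure A? ¬Ab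
    ... | cut , ¬A-cut , A-below-cut =
      toℕ cut , n≢0⇒n>0 cut≢0 , toℕ<n cut , cut⇒skewSplit A? no-crossing ¬A-cut A-below-cut
      where
      cut≢0 : toℕ cut ≢ 0
      cut≢0 cut≡0 = ¬A-cut (subst A (toℕ-injective (trans a≡0 (sym cut≡0))) Aa)

  disconnected⇒skewSplit : ∀ {π : Vec (Fin n) n} → IsPerm π → Disconnected π → ∃ λ k → 1 ≤ k × k < n × SkewSplit k π
  disconnected⇒skewSplit {suc n} {π} injective (S , (a , a∈S) , (b , b∉S) , separated) with zero ∈ˢ? S
  ... | yes 0∈S = cut-exists injective (_∈ˢ? S) separated refl 0∈S b∉S
  ... | no 0∉S  = cut-exists injective (λ i → ¬? (i ∈ˢ? S)) separated′ refl 0∉S (λ a∉S → a∉S a∈S)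
    where
    separated′ : ∀ i j → i ∉ˢ S → ¬ j ∉ˢ S → ¬ Edge π i j × ¬ Edge π j i
    separated′ i j i∉S ¬j∉S = swap (separated j i (decidable-stable (j ∈ˢ? S) ¬j∉S) i∉S)

  -- Factorial sums

  sumRange : (ℕ → ℕ) → ℕ → ℕ → ℕ
  sumRange f lo zero    = 0
  sumRange f lo (suc d) = f lo + sumRange f (suc lo) d

  sumRange-cong : ∀ {f g} lo d → (∀ k → lo ≤ k → k < lo + d → f k ≡ g k) → sumRange f lo d ≡ sumRange g lo d
  sumRange-cong lo zero    f≡g = refl
  sumRange-cong lo (suc d) f≡g = cong₂ _+_ (f≡g lo ≤-refl (m<m+n lo z<s))
    (sumRange-cong (suc lo) d (λ k lo<k k<lo+1+d → f≡g k (<⇒≤ lo<k) (subst (k <_) (sym (+-suc lo d)) k<lo+1+d)))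

  sumRange-≤ : ∀ {f} C lo d → (∀ k → lo ≤ k → k < lo + d → f k ≤ C) → sumRange f lo d ≤ d * C
  sumRange-≤ C lo zero    f≤C = z≤n
  sumRange-≤ C lo (suc d) f≤C = +-mono-≤ (f≤C lo ≤-refl (m<m+n lo z<s))
    (sumRange-≤ C (suc lo) d (λ k lo<k k<lo+1+d → f≤C k (<⇒≤ lo<k) (subst (k <_) (sym (+-suc lo d)) k<lo+1+d)))

  sumRange-snoc : ∀ f lo d → sumRange f lo (suc d) ≡ sumRange f lo d + f (lo + d)
  sumRange-snoc f lo zero    = trans (+-identityʳ (f lo)) (cong f (sym (+-identityʳ lo)))
  sumRange-snoc f lo (suc d) = begin
    f lo + sumRange f (suc lo) (suc d)          ≡⟨ cong (f lo +_) (sumRange-snoc f (suc lo) d) ⟩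
    f lo + (sumRange f (suc lo) d + f (suc lo + d)) ≡⟨ +-assoc (f lo) _ _ ⟨
    f lo + sumRange f (suc lo) d + f (suc lo + d)   ≡⟨ cong (λ k → f lo + sumRange f (suc lo) d + f k) (+-suc lo d) ⟨
    f lo + sumRange f (suc lo) d + f (lo + suc d)   ∎
    where open ≡-Reasoning

  count-union-range : {A : Set} {P : Pred A 0ℓ} (P? : Decidable P) {Q : ℕ → Pred A 0ℓ} (Q? : ∀ k → Decidable (Q k)) →
    ∀ lo d → (∀ {x} → P x → ∃ λ k → lo ≤ k × k < lo + d × Q k x) →
    ∀ xs → count P? xs ≤ sumRange (λ k → count (Q? k) xs) lo d
  count-union-range {P = P} P? Q? lo zero P⊆⋃Q xs = ≤-reflexive (count-empty P? none xs)
    where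
    none : ∀ x → ¬ P x
    none x px with P⊆⋃Q px
    ... | k , lo≤k , k<lo+0 , _ = <⇒≱ k<lo+0 (subst (_≤ k) (sym (+-identityʳ lo)) lo≤k)
  count-union-range {P = P} P? {Q} Q? lo (suc d) P⊆⋃Q xs = ≤-trans
    (count-union P? (Q? lo) (P? ∩? ∁? (Q? lo)) split xs)
    (+-monoʳ-≤ (count (Q? lo) xs) (count-union-range (P? ∩? ∁? (Q? lo)) Q? (suc lo) d rest xs))
    where
    split : ∀ {x} → P x → Q lo x ⊎ (P x × ¬ Q lo x)
    split {x} px with Q? lo x
    ... | yes q = inj₁ q
    ... | no ¬q = inj₂ (px , ¬q)
    rest : ∀ {x} → P x × ¬ Q lo x → ∃ λ k → suc lo ≤ k × k < suc lo + d × Q k x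
    rest (px , ¬q) with P⊆⋃Q px
    ... | k , lo≤k , k<lo+1+d , q = k , ≤∧≢⇒< lo≤k (λ { refl → ¬q q }) , subst (k <_) (+-suc lo d) k<lo+1+d , q

  factorial-exchange : ∀ c a b → (c + a) ! * (c + b) ! ≤ c ! * (c + a + b) !
  factorial-exchange c zero    b = ≤-reflexive (cong₂ (λ x y → x ! * y !) (+-identityʳ c) (cong (_+ b) (sym (+-identityʳ c))))
  factorial-exchange c (suc a) b = begin
    (c + suc a) ! * (c + b) !                    ≡⟨ cong (λ x → x ! * (c + b) !) (+-suc c a) ⟩
    suc (c + a) * (c + a) ! * (c + b) !          ≡⟨ *-assoc (suc (c + a)) ((c + a) !) ((c + b) !) ⟩
    suc (c + a) * ((c + a) ! * (c + b) !)        ≤⟨ *-monoʳ-≤ (suc (c + a)) (factorial-exchange c a b) ⟩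
    suc (c + a) * (c ! * (c + a + b) !)          ≡⟨ x*[y*z]≡y*[x*z] (suc (c + a)) (c !) _ ⟩
    c ! * (suc (c + a) * (c + a + b) !)          ≤⟨ *-monoʳ-≤ (c !) (*-monoˡ-≤ ((c + a + b) !) (s≤s (m≤m+n (c + a) b))) ⟩
    c ! * (suc (c + a + b) * (c + a + b) !)      ≡⟨ cong (λ x → c ! * (x + b) !) (+-suc c a) ⟨
    c ! * (c + suc a + b) !                      ∎
    where open ≤-Reasoning

  term : ℕ → ℕ → ℕ
  term n k = k ! * (n ∸ k) !

  term-≤ : ∀ {n} c k → c ≤ k → c + k ≤ n → term n k ≤ term n c
  term-≤ {n} c k c≤k c+k≤n = subst₂ (λ x y → x ! * y ! ≤ c ! * (n ∸ c) !) (m+[n∸m]≡n c≤k) (m+[n∸m]≡n c≤n∸k)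
    (subst (λ x → (c + (k ∸ c)) ! * (c + (n ∸ k ∸ c)) ! ≤ c ! * x !) total (factorial-exchange c (k ∸ c) (n ∸ k ∸ c)))
    where
    open ≡-Reasoning
    c≤n∸k : c ≤ n ∸ k
    c≤n∸k = m+n≤o⇒m≤o∸n c c+k≤n
    total : c + (k ∸ c) + (n ∸ k ∸ c) ≡ n ∸ c
    total = begin
      c + (k ∸ c) + (n ∸ k ∸ c) ≡⟨ cong (_+ (n ∸ k ∸ c)) (m+[n∸m]≡n c≤k) ⟩
      k + (n ∸ k ∸ c)           ≡⟨ +-∸-assoc k c≤n∸k ⟨
      k + (n ∸ k) ∸ c           ≡⟨ cong (_∸ c) (m+[n∸m]≡n (≤-trans (m≤n+m k c) c+k≤n)) ⟩
      n ∸ c                     ∎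

  -- The end terms are (n − 1)! and each of the n − 3 others is at most 2! (n − 2)!.
  sum-terms-≤-4 : ∀ m → sumRange (term (2 + m)) 1 (1 + m) ≤ 4 * (1 + m) !
  sum-terms-≤-4 zero     = s≤s z≤n
  sum-terms-≤-4 (suc m) = begin
    f 1 + sumRange f 2 (suc m)       ≡⟨ cong (f 1 +_) (sumRange-snoc f 2 m) ⟩
    f 1 + (sumRange f 2 m + f (2 + m)) ≤⟨ +-mono-≤ first (+-mono-≤ middle last) ⟩
    X + (m * (2 * Y) + X)             ≤⟨ +-monoʳ-≤ X (+-monoˡ-≤ X (*-monoˡ-≤ (2 * Y) (m≤n+m m 2))) ⟩
    X + ((2 + m) * (2 * Y) + X)       ≡⟨ rearrange m Y ⟩
    4 * X                             ∎
    where
    open ≤-Reasoning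
    f : ℕ → ℕ
    f = term (3 + m)
    X Y : ℕ
    X = (2 + m) !
    Y = (1 + m) !
    first : f 1 ≤ X
    first = ≤-reflexive (*-identityˡ X)
    last : f (2 + m) ≤ X
    last = ≤-trans (term-≤ 1 (2 + m) (s≤s z≤n) ≤-refl) first
    middle : sumRange f 2 m ≤ m * (2 * Y)
    middle = sumRange-≤ (2 * Y) 2 m (λ k 2≤k k<2+m → term-≤ 2 k 2≤k (s≤s (s≤s (s≤s⁻¹ k<2+m))))
    rearrange : ∀ m Y → (2 + m) * Y + ((2 + m) * (2 * Y) + (2 + m) * Y) ≡ 4 * ((2 + m) * Y)
    rearrange = solve-∀

  -- The terms at 1 and n − 1 are (n − 1)!, those at 2 and n − 2 are 2 (n − 2)!, and the n − 5
  -- others are each at most 3! (n − 3)!, together at most 6 (n − 2)!.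
  sum-terms-≤ : ∀ p → sumRange (term (5 + p)) 1 (4 + p) ≤ 2 * (4 + p) ! + 10 * (3 + p) !
  sum-terms-≤ p = begin
    f 1 + (f 2 + sumRange f 3 (2 + p))
      ≡⟨ cong (λ s → f 1 + (f 2 + s)) (trans (sumRange-snoc f 3 (suc p)) (cong (_+ f (3 + suc p)) (sumRange-snoc f 3 p))) ⟩
    f 1 + (f 2 + ((sumRange f 3 p + f (3 + p)) + f (4 + p)))
      ≤⟨ +-mono-≤ first (+-monoʳ-≤ (f 2) (+-mono-≤ (+-mono-≤ middle second-last) last)) ⟩
    X + (2 * Y + ((p * (6 * Z) + 2 * Y) + X))
      ≤⟨ +-monoʳ-≤ X (+-monoʳ-≤ (2 * Y) (+-monoˡ-≤ X (+-monoˡ-≤ (2 * Y) (*-monoˡ-≤ (6 * Z) (m≤n+m p 3))))) ⟩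
    X + (2 * Y + (((3 + p) * (6 * Z) + 2 * Y) + X))
      ≡⟨ rearrange p Z ⟩
    2 * X + 10 * Y ∎
    where
    open ≤-Reasoning
    f : ℕ → ℕ
    f = term (5 + p)
    X Y Z : ℕ
    X = (4 + p) !
    Y = (3 + p) !
    Z = (2 + p) !
    first : f 1 ≤ X
    first = ≤-reflexive (*-identityˡ X)
    last : f (4 + p) ≤ X
    last = ≤-trans (term-≤ 1 (4 + p) (s≤s z≤n) ≤-refl) first
    second-last : f (3 + p) ≤ 2 * Y
    second-last = term-≤ 2 (3 + p) (s≤s (s≤s z≤n)) ≤-refl
    middle : sumRange f 3 p ≤ p * (6 * Z)
    middle = sumRange-≤ (6 * Z) 3 p (λ k 3≤k k<3+p → term-≤ 3 k 3≤k (s≤s (s≤s (s≤s (s≤s⁻¹ k<3+p)))))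
    rearrange : ∀ p Z →
      (4 + p) * ((3 + p) * Z) + (2 * ((3 + p) * Z) + (((3 + p) * (6 * Z) + 2 * ((3 + p) * Z)) + (4 + p) * ((3 + p) * Z)))
        ≡ 2 * ((4 + p) * ((3 + p) * Z)) + 10 * ((3 + p) * Z)
    rearrange = solve-∀

  perm∩disconnected? : ∀ {n} → Decidable {A = Vec (Fin n) n} (λ π → IsPerm π × Disconnected π)
  perm∩disconnected? = isPerm? ∩? disconnected?

  countDisconnected≡count : ∀ n → countDisconnected n ≡ count perm∩disconnected? (allVecs n n)
  countDisconnected≡count n = length-filter≡count perm∩disconnected? (allVecs n n)

  skewSplit⇒perm∩disconnected : ∀ {n k} {π : Vec (Fin n) n} → 1 ≤ k → k < n → SkewSplit k π → IsPerm π × Disconnected π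
  skewSplit⇒perm∩disconnected 1≤k k<n skew = lookup-injective (proj₁ skew) , skewSplit⇒disconnected 1≤k k<n skew

  count-skewSplit-≤ : ∀ {n k} → 1 ≤ k → k < n → k ! * (n ∸ k) ! ≤ countDisconnected n
  count-skewSplit-≤ {n} {k} 1≤k k<n = begin
    k ! * (n ∸ k) !                                    ≡⟨ count-skewSplit 1≤k (<⇒≤ k<n) ⟨
    count (admissible? (skewIntervals n k)) (allVecs n n) ≤⟨ count-mono (admissible? (skewIntervals n k)) perm∩disconnected?
                                                                (skewSplit⇒perm∩disconnected 1≤k k<n) (allVecs n n) ⟩
    count perm∩disconnected? (allVecs n n)                 ≡⟨ countDisconnected≡count n ⟨
    countDisconnected n                                    ∎
    where open ≤-Reasoning

  count-disconnected-≥ : ∀ m → (1 + m) ! ≤ countDisconnected (2 + m)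
  count-disconnected-≥ m = ≤-trans (≤-reflexive (sym (*-identityˡ _))) (count-skewSplit-≤ {2 + m} {1} (s≤s z≤n) (s≤s (s≤s z≤n)))

  count-disconnected-≥₂ : ∀ m → (1 + m) ! + (1 + m) ! ≤ countDisconnected (2 + m) + m !
  count-disconnected-≥₂ m = begin
    (1 + m) ! + (1 + m) !
      ≡⟨ cong₂ _+_ (trans (count-skewSplit {2 + m} (s≤s z≤n) (s≤s z≤n)) (*-identityˡ _))
                     (trans (count-skewSplit {2 + m} (s≤s z≤n) (n≤1+n _)) last-factor) ⟨
    count first? vs + count last? vs
      ≤⟨ count-inclusion-exclusion perm∩disconnected? first? last? (admissible? (bothEndsIntervals m))
           (skewSplit⇒perm∩disconnected (s≤s z≤n) (s≤s (s≤s z≤n)))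
           (skewSplit⇒perm∩disconnected (s≤s z≤n) ≤-refl)
           (λ (first , last) → skewSplit-both-ends m first last) vs ⟩
    count perm∩disconnected? vs + count (admissible? (bothEndsIntervals m)) vs
      ≡⟨ cong₂ _+_ (countDisconnected≡count (2 + m)) (sym (count-bothEnds m)) ⟨
    countDisconnected (2 + m) + m ! ∎
    where
    open ≤-Reasoning
    vs : List (Vec (Fin (2 + m)) (2 + m))
    vs = allVecs (2 + m) (2 + m)
    first? : Decidable (Admissible (skewIntervals (2 + m) 1))
    first? = admissible? (skewIntervals (2 + m) 1)
    last? : Decidable (Admissible (skewIntervals (2 + m) (1 + m)))
    last? = admissible? (skewIntervals (2 + m) (1 + m))
    last-factor : (1 + m) ! * (1 + m ∸ m) ! ≡ (1 + m) !
    last-factor = trans (cong (λ k → (1 + m) ! * k !) (m+n∸n≡m 1 m)) (*-identityʳ _)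

  count-disconnected-≤ : ∀ m → countDisconnected (2 + m) ≤ sumRange (term (2 + m)) 1 (1 + m)
  count-disconnected-≤ m = begin
    countDisconnected N
      ≡⟨ countDisconnected≡count N ⟩
    count perm∩disconnected? (allVecs N N)
      ≤⟨ count-union-range perm∩disconnected? (λ k → admissible? (skewIntervals N k)) 1 (1 + m)
           (λ (perm , disconnected) → disconnected⇒skewSplit perm disconnected) (allVecs N N) ⟩
    sumRange (λ k → count (admissible? (skewIntervals N k)) (allVecs N N)) 1 (1 + m)
      ≡⟨ sumRange-cong 1 (1 + m) (λ k 1≤k k<N → count-skewSplit 1≤k (<⇒≤ k<N)) ⟩
    sumRange (term N) 1 (1 + m) ∎
    where
    open ≤-Reasoning
    N : ℕ
    N = 2 + m

  n·count-≤ : ∀ p → (5 + p) * countDisconnected (5 + p) ≤ 2 * (5 + p) ! + (5 + p) * (10 * (3 + p) !)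
  n·count-≤ p = begin
    N * c                      ≤⟨ *-monoʳ-≤ N (≤-trans (count-disconnected-≤ (3 + p)) (sum-terms-≤ p)) ⟩
    N * (2 * X + 10 * Y)       ≡⟨ distrib N X Y ⟩
    2 * (N * X) + N * (10 * Y) ∎
    where
    open ≤-Reasoning
    N c X Y : ℕ
    N = 5 + p
    c = countDisconnected N
    X = (4 + p) !
    Y = (3 + p) !
    distrib : ∀ a x y → a * (2 * x + 10 * y) ≡ 2 * (a * x) + a * (10 * y)
    distrib = solve-∀

  2·n!-≤ : ∀ p → 2 * (5 + p) ! ≤ (5 + p) * countDisconnected (5 + p) + (5 + p) * (10 * (3 + p) !)
  2·n!-≤ p = begin
    2 * (N * X)          ≡⟨ distrib N X ⟩
    N * (X + X)          ≤⟨ *-monoʳ-≤ N (count-disconnected-≥₂ (3 + p)) ⟩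
    N * (c + Y)          ≤⟨ *-monoʳ-≤ N (+-monoʳ-≤ c (m≤n*m Y 10)) ⟩
    N * (c + 10 * Y)     ≡⟨ *-distribˡ-+ N c (10 * Y) ⟩
    N * c + N * (10 * Y) ∎
    where
    open ≤-Reasoning
    N c X Y : ℕ
    N = 5 + p
    c = countDisconnected N
    X = (4 + p) !
    Y = (3 + p) !
    distrib : ∀ a x → 2 * (a * x) ≡ a * (x + x)
    distrib = solve-∀
open Combinatorics

open import Data.Integer as ℤ using (+_; -[1+_])
import Data.Integer.Properties as ℤ
open import Data.Rational using (ℚ; mkℚ; _≤_; _<_; _+_; _*_; _-_; -_; ∣_∣; 0ℚ; _/_; toℚᵘ)
import Data.Rational as ℚ
open import Data.Rational.Properties as ℚ
  using (toℚᵘ-fromℚᵘ; toℚᵘ-cancel-≤; toℚᵘ-injective; toℚᵘ-homo-+; toℚᵘ-homo-*; ∣p∣≡p∨∣p∣≡-p; +-monoˡ-≤; +-0-abelianGroup)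
open import Data.Rational.Unnormalised as ℚᵘ using (mkℚᵘ; *≤*; *≡*) renaming (_≃_ to _≃ᵘ_)
import Data.Rational.Unnormalised.Properties as ℚᵘ
open import Algebra.Properties.AbelianGroup +-0-abelianGroup using (⁻¹-anti-homo‿-; xyx⁻¹≈y)
open import Data.Nat.Tactic.RingSolver using (solve-∀)

-- Fractions

toℚᵘ-/ : ∀ a D .{{_ : NonZero D}} → toℚᵘ (+ a / D) ≃ᵘ mkℚᵘ (+ a) (pred D)
toℚᵘ-/ a (suc d) = toℚᵘ-fromℚᵘ (mkℚᵘ (+ a) d)

/-≤ : ∀ a b D D′ .{{_ : NonZero D}} .{{_ : NonZero D′}} → a ℕ.* D′ ℕ.≤ b ℕ.* D → + a / D ≤ + b / D′
/-≤ a b D@(suc _) D′@(suc _) aD′≤bD = toℚᵘ-cancel-≤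
  (ℚᵘ.≤-respˡ-≃ (ℚᵘ.≃-sym (toℚᵘ-/ a D)) (ℚᵘ.≤-respʳ-≃ (ℚᵘ.≃-sym (toℚᵘ-/ b D′))
    (*≤* (subst₂ ℤ._≤_ (ℤ.pos-* a D′) (ℤ.pos-* b D) (ℤ.+≤+ aD′≤bD)))))

/-≡ : ∀ a b D D′ .{{_ : NonZero D}} .{{_ : NonZero D′}} → a ℕ.* D′ ≡ b ℕ.* D → + a / D ≡ + b / D′
/-≡ a b D@(suc _) D′@(suc _) aD′≡bD = toℚᵘ-injective
  (ℚᵘ.≃-trans (toℚᵘ-/ a D) (ℚᵘ.≃-trans
    (*≡* (trans (sym (ℤ.pos-* a D′)) (trans (cong +_ aD′≡bD) (ℤ.pos-* b D))))
    (ℚᵘ.≃-sym (toℚᵘ-/ b D′))))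

/-+ : ∀ a b D .{{_ : NonZero D}} → + a / D + + b / D ≡ + (a ℕ.+ b) / D
/-+ a b D@(suc _) = toℚᵘ-injective (ℚᵘ.≃-trans (toℚᵘ-homo-+ (+ a / D) (+ b / D))
  (ℚᵘ.≃-trans (ℚᵘ.+-cong (toℚᵘ-/ a D) (toℚᵘ-/ b D))
  (ℚᵘ.≃-trans (*≡* cross) (ℚᵘ.≃-sym (toℚᵘ-/ (a ℕ.+ b) D)))))
  where
  distrib : ∀ A B D → (A ℤ.* D ℤ.+ B ℤ.* D) ℤ.* D ≡ (A ℤ.+ B) ℤ.* (D ℤ.* D)
  distrib A B D = trans (cong (ℤ._* D) (sym (ℤ.*-distribʳ-+ D A B))) (ℤ.*-assoc (A ℤ.+ B) D D)
  cross : (+ a ℤ.* + D ℤ.+ + b ℤ.* + D) ℤ.* + D ≡ + (a ℕ.+ b) ℤ.* + (D ℕ.* D)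
  cross = trans (distrib (+ a) (+ b) (+ D)) (cong₂ ℤ._*_ (sym (ℤ.pos-+ a b)) (sym (ℤ.pos-* D D)))

/-* : ∀ a b D .{{_ : NonZero D}} → (+ a / 1) * (+ b / D) ≡ + (a ℕ.* b) / D
/-* a b D@(suc d) = toℚᵘ-injective (ℚᵘ.≃-trans (toℚᵘ-homo-* (+ a / 1) (+ b / D))
  (ℚᵘ.≃-trans (ℚᵘ.*-cong (toℚᵘ-/ a 1) (toℚᵘ-/ b D))
  (ℚᵘ.≃-trans (*≡* (cong₂ ℤ._*_ (sym (ℤ.pos-* a b)) (cong (λ k → + suc k) (sym (ℕ.+-identityʳ d)))))
  (ℚᵘ.≃-sym (toℚᵘ-/ (a ℕ.* b) D)))))


∣-∣-≤ : ∀ {p q e} → p ≤ q + e → q ≤ p + e → ∣ p - q ∣ ≤ e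
∣-∣-≤ {p} {q} {e} p≤q+e q≤p+e with ∣p∣≡p∨∣p∣≡-p (p - q)
... | inj₁ ∣p-q∣≡p-q  = subst (_≤ e) (sym ∣p-q∣≡p-q)
  (subst (p - q ≤_) (xyx⁻¹≈y q e) (+-monoˡ-≤ (- q) p≤q+e))
... | inj₂ ∣p-q∣≡-[p-q] = subst (_≤ e) (sym (trans ∣p-q∣≡-[p-q] (⁻¹-anti-homo‿- p q)))
  (subst (q - p ≤_) (xyx⁻¹≈y p e) (+-monoˡ-≤ (- p) q≤p+e))

∣/-/∣-≤ : ∀ {a b e} D .{{_ : NonZero D}} → a ℕ.≤ b ℕ.+ e → b ℕ.≤ a ℕ.+ e → ∣ + a / D - + b / D ∣ ≤ + e / D
∣/-/∣-≤ {a} {b} {e} D a≤b+e b≤a+e = ∣-∣-≤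
  (subst (+ a / D ≤_) (sym (/-+ b e D)) (/-≤ a (b ℕ.+ e) D D (ℕ.*-monoˡ-≤ D a≤b+e)))
  (subst (+ b / D ≤_) (sym (/-+ a e D)) (/-≤ b (a ℕ.+ e) D D (ℕ.*-monoˡ-≤ D b≤a+e)))

p₀-bounds : ∀ m → (+ 1 / suc (suc m) ≤ p₀ (suc (suc m))) × (p₀ (suc (suc m)) ≤ + 4 / suc (suc m))
p₀-bounds m = /-≤ 1 c n (n !) lower , /-≤ c 4 (n !) n upper
  where
  n c : ℕ
  n = 2 ℕ.+ m
  c = countDisconnected n
  instance _ = n !≢0
  lower : 1 ℕ.* n ! ℕ.≤ c ℕ.* n
  lower = begin
    1 ℕ.* n !            ≡⟨ ℕ.*-identityˡ (n !) ⟩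
    n ℕ.* (1 ℕ.+ m) !    ≤⟨ ℕ.*-monoʳ-≤ n (count-disconnected-≥ m) ⟩
    n ℕ.* c              ≡⟨ ℕ.*-comm n c ⟩
    c ℕ.* n              ∎
    where open ℕ.≤-Reasoning
  upper : c ℕ.* n ℕ.≤ 4 ℕ.* n !
  upper = begin
    c ℕ.* n                   ≤⟨ ℕ.*-monoˡ-≤ n (ℕ.≤-trans (count-disconnected-≤ m) (sum-terms-≤-4 m)) ⟩
    4 ℕ.* (1 ℕ.+ m) ! ℕ.* n   ≡⟨ rearrange ((1 ℕ.+ m) !) n ⟩
    4 ℕ.* (n ℕ.* (1 ℕ.+ m) !) ∎
    where
    open ℕ.≤-Reasoning
    rearrange : ∀ X n → 4 ℕ.* X ℕ.* n ≡ 4 ℕ.* (n ℕ.* X)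
    rearrange = solve-∀

n·p₀-close : ∀ p → ∣ (+ (5 ℕ.+ p) / 1) * p₀ (5 ℕ.+ p) - + 2 / 1 ∣ ≤ + 10 / (4 ℕ.+ p)
n·p₀-close p = begin
  ∣ (+ n / 1) * p₀ n - + 2 / 1 ∣
    ≡⟨ cong₂ (λ x t → ∣ x - t ∣) (/-* n c (n !)) (/-≡ 2 (2 ℕ.* n !) 1 (n !) (sym (ℕ.*-identityʳ (2 ℕ.* n !)))) ⟩
  ∣ + (n ℕ.* c) / n ! - + (2 ℕ.* n !) / n ! ∣
    ≤⟨ ∣/-/∣-≤ (n !) (n·count-≤ p) (2·n!-≤ p) ⟩
  + E / n !
    ≡⟨ /-≡ E 10 (n !) (4 ℕ.+ p) (E-ratio p ((3 ℕ.+ p) !)) ⟩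
  + 10 / (4 ℕ.+ p) ∎
  where
  open ℚ.≤-Reasoning
  n c E : ℕ
  n = 5 ℕ.+ p
  c = countDisconnected n
  E = n ℕ.* (10 ℕ.* (3 ℕ.+ p) !)
  instance _ = n !≢0
  E-ratio : ∀ p Y → (5 ℕ.+ p) ℕ.* (10 ℕ.* Y) ℕ.* (4 ℕ.+ p) ≡ 10 ℕ.* ((5 ℕ.+ p) ℕ.* ((4 ℕ.+ p) ℕ.* Y))
  E-ratio = solve-∀

-- ε = (1 + a)/(1 + b), and from n = 10 (1 + b) + 5 on, 10/(n − 1) ≤ 1/(1 + b) ≤ ε.
n·p₀→2 : (ε : ℚ) → 0ℚ < ε → ∃ λ (N : ℕ) → (n : ℕ) → n ≥ N → ∣ (+ n / 1) * p₀ n - (+ 2 / 1) ∣ ≤ ε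
n·p₀→2 (mkℚ (+ zero)  _ _) (ℚ.*<* 0<0) = ⊥-elim (ℤ.<-irrefl refl 0<0)
n·p₀→2 (mkℚ -[1+ _ ] _ _) (ℚ.*<* ())
n·p₀→2 ε@(mkℚ (+ suc a) b coprime) _ = 10 ℕ.* suc b ℕ.+ 5 , λ n n≥N →
  subst (λ n → ∣ (+ n / 1) * p₀ n - + 2 / 1 ∣ ≤ ε) (ℕ.m+[n∸m]≡n (ℕ.≤-trans (ℕ.m≤n+m 5 (10 ℕ.* suc b)) n≥N))
    (ℚ.≤-trans (n·p₀-close (n ℕ.∸ 5)) (10/[4+p]≤ε (ℕ.m+n≤o⇒m≤o∸n (10 ℕ.* suc b) n≥N)))
  where
  10/[4+p]≤ε : ∀ {p} → 10 ℕ.* suc b ℕ.≤ p → + 10 / (4 ℕ.+ p) ≤ ε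
  10/[4+p]≤ε {p} 10[1+b]≤p = subst (+ 10 / (4 ℕ.+ p) ≤_) (ℚ.normalize-coprime coprime)
    (/-≤ 10 (suc a) (4 ℕ.+ p) (suc b) (ℕ.≤-trans 10[1+b]≤p (ℕ.≤-trans (ℕ.m≤n+m p 4) (ℕ.m≤n*m (4 ℕ.+ p) (suc a)))))

claim4p2 :
    ((m : ℕ) → ((+ 1 / suc (suc m)) ≤ p₀ (suc (suc m)))
             × (p₀ (suc (suc m)) ≤ (+ 4 / suc (suc m))))
    × ((ε : ℚ) → 0ℚ < ε →
        ∃ λ (N : ℕ) → (n : ℕ) → n ≥ N → ∣ (+ n / 1) * p₀ n - (+ 2 / 1) ∣ ≤ ε)
claim4p2 = p₀-bounds , n·p₀→2
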